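{- The functor $\Upsilon$ is not strong monoidal from $(\mathfrak Q,\vec\Box,\vec V^{\diamond}(\{1\}))$ to either $(\mathfrak R,\blacksquare,\check V^{\diamond}(\{1\}))$ or $(\mathfrak R,\check\Box,\check V^{\diamond}(\{1\}))$; and neither of its adjoints $\Upsilon^{\star}$, $\Upsilon^{\diamond}$ is strong monoidal from $(\mathfrak R,\blacksquare,\check V^{\diamond}(\{1\}))$ or from $(\mathfrak R,\check\Box,\check V^{\diamond}(\{1\}))$ to $(\mathfrak Q,\vec\Box,\vec V^{\diamond}(\{1\}))$.
   Context: Quivers: $Q=(\vec V(Q),\vec E(Q),\sigma_Q,\tau_Q)$ with source/target maps $\vec E(Q)\to\vec V(Q)$; homomorphisms preserve them; category $\mathfrak Q$. Quiver box product: $\vec V(Q\vec\Box P)=\vec V(Q)\times\vec V(P)$, $\vec E(Q\vec\Box P)=(\{1\}\times\vec E(Q)\times\vec V(P))\cup(\{2\}\times\vec V(Q)\times\vec E(P))$, $\sigma(1,x,y)=(\sigma_Qx,y)$, $\sigma(2,x,y)=(x,\sigma_Py)$, $\tau(1,x,y)=(\tau_Qx,y)$, $\tau(2,x,y)=(x,\tau_Py)$; unit $\vec V^\diamond(\{1\})$ = one vertex, no edges. Incidence hypergraphs: $G=(\check V(G),\check E(G),I(G),\varsigma_G:I(G)\to\check V(G),\omega_G:I(G)\to\check E(G))$, homomorphisms are triples of functions commuting with $\varsigma,\omega$; category $\mathfrak R$; unit $\check V^\diamond(\{1\})$ = one vertex, no edges, no incidences. Incidence box product $G\check\Box H$: vertices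 $\check V(G)\times\check V(H)$, edges $(\{1\}\times\check E(G)\times\check V(H))\cup(\{2\}\times\check V(G)\times\check E(H))$, incidences $(\{1\}\times I(G)\times\check V(H))\cup(\{2\}\times\check V(G)\times I(H))$, $\varsigma(1,x,y)=(\varsigma_Gx,y)$, $\varsigma(2,x,y)=(x,\varsigma_Hy)$, $\omega(1,x,y)=(1,\omega_Gx,y)$, $\omega(2,x,y)=(2,x,\omega_Hy)$. Laplacian product $G\blacksquare H$: vertices $(\{1\}\times\check V(G)\times\check V(H))\cup(\{4\}\times\check E(G)\times\check E(H))$, edges $(\{2\}\times\check E(G)\times\check V(H))\cup(\{3\}\times\check V(G)\times\check E(H))$, incidences $(\{1\}\times I(G)\times\check V(H))\cup(\{2\}\times I(G)\times\check E(H))\cup(\{3\}\times\check E(G)\times I(H))\cup(\{4\}\times\check V(G)\times I(H))$, $\varsigma(1,x,y)=(1,\varsigma_Gx,y)$, $\varsigma(2,x,y)=(4,\omega_Gx,y)$, $\varsigma(3,x,y)=(4,x,\omega_Hy)$, $\varsigma(4,x,y)=(1,x,\varsigma_Hy)$, $\omega(1,x,y)=(2,\omega_Gx,y)$, $\omega(2,x,y)=(3,\varsigma_Gx,y)$, $\omega(3,x,y)=(2,x,\varsigma_Hy)$, $\omega(4,x,y)=(3,x,\omega_Hy)$. (Both are symmetric monoidal products on $\mathfrak R$ with unit $\check V^\diamond(\{1\})$; morphisms act componentwise.) $\Upsilon:\mathfrak Q\to\mathfrak R$: $\Upsilon(Q)=(\vec V(Q),\vec V(Q),\vec E(Q),\sigma_Q,\tau_Q)$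 (vertex set and edge set both $\vec V(Q)$, incidences $\vec E(Q)$, $\varsigma=\sigma_Q$, $\omega=\tau_Q$). $\Upsilon^\diamond$ is its left adjoint: $\vec V(\Upsilon^\diamond G)=(\{1\}\times\check V(G))\cup(\{2\}\times\check E(G))$, $\vec E(\Upsilon^\diamond G)=I(G)$, $\sigma(i)=(1,\varsigma_Gi)$, $\tau(i)=(2,\omega_Gi)$. $\Upsilon^\star$ is its right adjoint. "Strong monoidal" means admitting structure isomorphisms $F(A)\otimes F(B)\cong F(A\otimes B)$ natural in $A,B$ and $\mathbf 1\cong F(\mathbf 1)$ satisfying the standard coherence conditions. -}

module Defs where

open import Data.Product using (_×_; _,_; proj₁; proj₂)
open import Data.Sum using (_⊎_; inj₁; inj₂)
open import Data.Unit using (⊤; tt)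
open import Data.Empty using (⊥)
open import Relation.Binary.PropositionalEquality using (_≡_; refl; cong; trans)

record MonCat : Set₂ where
  infixr 9 _∘_
  infixr 10 _⊗₁_
  infix 4 _≈_
  field
    Obj   : Set₁
    Hom   : Obj → Obj → Set
    _≈_   : ∀ {A B} → Hom A B → Hom A B → Set
    id    : ∀ {A} → Hom A A
    _∘_   : ∀ {A B C} → Hom B C → Hom A B → Hom A C
    _⊗₀_  : Obj → Obj → Obj
    _⊗₁_  : ∀ {A B C D} → Hom A B → Hom C D → Hom (A ⊗₀ C) (B ⊗₀ D)
    𝟙     : Obj
    assoc⇒ : ∀ {A B C} → Hom ((A ⊗₀ B) ⊗₀ C) (A ⊗₀ (B ⊗₀ C))
    unitˡ⇒ : ∀ {A} → Hom (𝟙 ⊗₀ A) A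
    unitʳ⇒ : ∀ {A} → Hom (A ⊗₀ 𝟙) A

record IsIso (C : MonCat) {A B : MonCat.Obj C} (f : MonCat.Hom C A B) : Set where
  open MonCat C
  field
    inv   : Hom B A
    isoˡ  : inv ∘ f ≈ id
    isoʳ  : f ∘ inv ≈ id

record Fun (C D : MonCat) : Set₁ where
  field
    F₀ : MonCat.Obj C → MonCat.Obj D
    F₁ : ∀ {A B} → MonCat.Hom C A B → MonCat.Hom D (F₀ A) (F₀ B)

module _ (C D : MonCat) where
  private
    module C = MonCat C
    module D = MonCat D

  record StrongMonoidal (F : Fun C D) : Set₁ where
    open Fun F
    field
      φ       : ∀ A B → D.Hom (F₀ A D.⊗₀ F₀ B) (F₀ (A C.⊗₀ B))
      φ-iso   : ∀ A B → IsIso D (φ A B)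
      φ-nat   : ∀ {A A′ B B′} (f : C.Hom A A′) (g : C.Hom B B′) →
                F₁ (f C.⊗₁ g) D.∘ φ A B D.≈ φ A′ B′ D.∘ (F₁ f D.⊗₁ F₁ g)
      φ₀      : D.Hom D.𝟙 (F₀ C.𝟙)
      φ₀-iso  : IsIso D φ₀
      coh-assoc : ∀ A B X →
        F₁ (C.assoc⇒ {A} {B} {X}) D.∘ φ (A C.⊗₀ B) X D.∘ (φ A B D.⊗₁ D.id)
          D.≈ φ A (B C.⊗₀ X) D.∘ (D.id D.⊗₁ φ B X) D.∘ D.assoc⇒
      coh-unitˡ : ∀ A → F₁ (C.unitˡ⇒ {A}) D.∘ φ C.𝟙 A D.∘ (φ₀ D.⊗₁ D.id) D.≈ D.unitˡ⇒
      coh-unitʳ : ∀ A → F₁ (C.unitʳ⇒ {A}) D.∘ φ A C.𝟙 D.∘ (D.id D.⊗₁ φ₀) D.≈ D.unitʳ⇒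

record Quiver : Set₁ where
  field
    V   : Set
    E   : Set
    src : E → V
    tgt : E → V
open Quiver

record QHom (Q P : Quiver) : Set where
  field
    fV : V Q → V P
    fE : E Q → E P
    src-comm : ∀ e → src P (fE e) ≡ fV (src Q e)
    tgt-comm : ∀ e → tgt P (fE e) ≡ fV (tgt Q e)
open QHom

_≈Q_ : ∀ {Q P} → QHom Q P → QHom Q P → Set
f ≈Q g = (∀ v → fV f v ≡ fV g v) × (∀ e → fE f e ≡ fE g e)

idQ : ∀ {Q} → QHom Q Q
idQ = record { fV = λ v → v ; fE = λ e → e ; src-comm = λ _ → refl ; tgt-comm = λ _ → refl }

_∘Q_ : ∀ {Q P R} → QHom P R → QHom Q P → QHom Q R
g ∘Q f = record
  { fV = λ v → fV g (fV f v) ; fE = λ e → fE g (fE f e)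
  ; src-comm = λ e → trans (src-comm g (fE f e)) (cong (fV g) (src-comm f e))
  ; tgt-comm = λ e → trans (tgt-comm g (fE f e)) (cong (fV g) (tgt-comm f e)) }

-- quiver box product: edge tag 1 = inj₁, tag 2 = inj₂
_□Q_ : Quiver → Quiver → Quiver
Q □Q P = record
  { V = V Q × V P
  ; E = (E Q × V P) ⊎ (V Q × E P)
  ; src = λ { (inj₁ (x , y)) → (src Q x , y) ; (inj₂ (x , y)) → (x , src P y) }
  ; tgt = λ { (inj₁ (x , y)) → (tgt Q x , y) ; (inj₂ (x , y)) → (x , tgt P y) } }

_□Q₁_ : ∀ {Q Q′ P P′} → QHom Q Q′ → QHom P P′ → QHom (Q □Q P) (Q′ □Q P′)
f □Q₁ g = record
  { fV = λ { (x , y) → (fV f x , fV g y) }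
  ; fE = λ { (inj₁ (x , y)) → inj₁ (fE f x , fV g y) ; (inj₂ (x , y)) → inj₂ (fV f x , fE g y) }
  ; src-comm = λ { (inj₁ (x , y)) → cong (λ z → z , fV g y) (src-comm f x)
                 ; (inj₂ (x , y)) → cong (λ z → fV f x , z) (src-comm g y) }
  ; tgt-comm = λ { (inj₁ (x , y)) → cong (λ z → z , fV g y) (tgt-comm f x)
                 ; (inj₂ (x , y)) → cong (λ z → fV f x , z) (tgt-comm g y) } }

𝟙Q : Quiver
𝟙Q = record { V = ⊤ ; E = ⊥ ; src = λ () ; tgt = λ () }

assocQ : ∀ {Q P R} → QHom ((Q □Q P) □Q R) (Q □Q (P □Q R))
assocQ = record
  { fV = λ { ((x , y) , z) → (x , (y , z)) }
  ; fE = λ { (inj₁ (inj₁ (e , y) , z)) → inj₁ (e , (y , z))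
           ; (inj₁ (inj₂ (x , e) , z)) → inj₂ (x , inj₁ (e , z))
           ; (inj₂ ((x , y) , e)) → inj₂ (x , inj₂ (y , e)) }
  ; src-comm = λ { (inj₁ (inj₁ (e , y) , z)) → refl ; (inj₁ (inj₂ (x , e) , z)) → refl
                 ; (inj₂ ((x , y) , e)) → refl }
  ; tgt-comm = λ { (inj₁ (inj₁ (e , y) , z)) → refl ; (inj₁ (inj₂ (x , e) , z)) → refl
                 ; (inj₂ ((x , y) , e)) → refl } }

unitˡQ : ∀ {Q} → QHom (𝟙Q □Q Q) Q
unitˡQ = record
  { fV = λ { (tt , x) → x }
  ; fE = λ { (inj₁ (() , _)) ; (inj₂ (tt , e)) → e }
  ; src-comm = λ { (inj₁ (() , _)) ; (inj₂ (tt , e)) → refl }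
  ; tgt-comm = λ { (inj₁ (() , _)) ; (inj₂ (tt , e)) → refl } }

unitʳQ : ∀ {Q} → QHom (Q □Q 𝟙Q) Q
unitʳQ = record
  { fV = λ { (x , tt) → x }
  ; fE = λ { (inj₁ (e , tt)) → e ; (inj₂ (_ , ())) }
  ; src-comm = λ { (inj₁ (e , tt)) → refl ; (inj₂ (_ , ())) }
  ; tgt-comm = λ { (inj₁ (e , tt)) → refl ; (inj₂ (_ , ())) } }

QuivBox : MonCat
QuivBox = record
  { Obj = Quiver ; Hom = QHom ; _≈_ = _≈Q_ ; id = idQ ; _∘_ = _∘Q_
  ; _⊗₀_ = _□Q_ ; _⊗₁_ = _□Q₁_ ; 𝟙 = 𝟙Q
  ; assoc⇒ = assocQ ; unitˡ⇒ = unitˡQ ; unitʳ⇒ = unitʳQ }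

record IncHyp : Set₁ where
  field
    Vt : Set
    Ed : Set
    Inc : Set
    ς : Inc → Vt
    ω : Inc → Ed
open IncHyp

record RHom (G H : IncHyp) : Set where
  field
    hV : Vt G → Vt H
    hE : Ed G → Ed H
    hI : Inc G → Inc H
    ς-comm : ∀ i → ς H (hI i) ≡ hV (ς G i)
    ω-comm : ∀ i → ω H (hI i) ≡ hE (ω G i)
open RHom

_≈R_ : ∀ {G H} → RHom G H → RHom G H → Set
f ≈R g = (∀ v → hV f v ≡ hV g v) × (∀ e → hE f e ≡ hE g e) × (∀ i → hI f i ≡ hI g i)

idR : ∀ {G} → RHom G G
idR = record { hV = λ v → v ; hE = λ e → e ; hI = λ i → i
             ; ς-comm = λ _ → refl ; ω-comm = λ _ → refl }

_∘R_ : ∀ {G H K} → RHom H K → RHom G H → RHom G K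
g ∘R f = record
  { hV = λ v → hV g (hV f v) ; hE = λ e → hE g (hE f e) ; hI = λ i → hI g (hI f i)
  ; ς-comm = λ i → trans (ς-comm g (hI f i)) (cong (hV g) (ς-comm f i))
  ; ω-comm = λ i → trans (ω-comm g (hI f i)) (cong (hE g) (ω-comm f i)) }

𝟙R : IncHyp
𝟙R = record { Vt = ⊤ ; Ed = ⊥ ; Inc = ⊥ ; ς = λ () ; ω = λ () }

-- incidence box product (tags 1 = inj₁, 2 = inj₂)
_□R_ : IncHyp → IncHyp → IncHyp
G □R H = record
  { Vt = Vt G × Vt H
  ; Ed = (Ed G × Vt H) ⊎ (Vt G × Ed H)
  ; Inc = (Inc G × Vt H) ⊎ (Vt G × Inc H)
  ; ς = λ { (inj₁ (x , y)) → (ς G x , y) ; (inj₂ (x , y)) → (x , ς H y) }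
  ; ω = λ { (inj₁ (x , y)) → inj₁ (ω G x , y) ; (inj₂ (x , y)) → inj₂ (x , ω H y) } }

_□R₁_ : ∀ {G G′ H H′} → RHom G G′ → RHom H H′ → RHom (G □R H) (G′ □R H′)
f □R₁ g = record
  { hV = λ { (x , y) → (hV f x , hV g y) }
  ; hE = λ { (inj₁ (x , y)) → inj₁ (hE f x , hV g y) ; (inj₂ (x , y)) → inj₂ (hV f x , hE g y) }
  ; hI = λ { (inj₁ (x , y)) → inj₁ (hI f x , hV g y) ; (inj₂ (x , y)) → inj₂ (hV f x , hI g y) }
  ; ς-comm = λ { (inj₁ (x , y)) → cong (λ z → z , hV g y) (ς-comm f x)
               ; (inj₂ (x , y)) → cong (λ z → hV f x , z) (ς-comm g y) }
  ; ω-comm = λ { (inj₁ (x , y)) → cong (λ z → inj₁ (z , hV g y)) (ω-comm f x)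
               ; (inj₂ (x , y)) → cong (λ z → inj₂ (hV f x , z)) (ω-comm g y) } }

assoc□R : ∀ {G H K} → RHom ((G □R H) □R K) (G □R (H □R K))
assoc□R = record
  { hV = λ { ((x , y) , z) → (x , (y , z)) }
  ; hE = λ { (inj₁ (inj₁ (e , y) , z)) → inj₁ (e , (y , z))
           ; (inj₁ (inj₂ (x , e) , z)) → inj₂ (x , inj₁ (e , z))
           ; (inj₂ ((x , y) , e)) → inj₂ (x , inj₂ (y , e)) }
  ; hI = λ { (inj₁ (inj₁ (e , y) , z)) → inj₁ (e , (y , z))
           ; (inj₁ (inj₂ (x , e) , z)) → inj₂ (x , inj₁ (e , z))
           ; (inj₂ ((x , y) , e)) → inj₂ (x , inj₂ (y , e)) }
  ; ς-comm = λ { (inj₁ (inj₁ (e , y) , z)) → refl ; (inj₁ (inj₂ (x , e) , z)) → refl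
               ; (inj₂ ((x , y) , e)) → refl }
  ; ω-comm = λ { (inj₁ (inj₁ (e , y) , z)) → refl ; (inj₁ (inj₂ (x , e) , z)) → refl
               ; (inj₂ ((x , y) , e)) → refl } }

unitˡ□R : ∀ {G} → RHom (𝟙R □R G) G
unitˡ□R = record
  { hV = λ { (tt , x) → x }
  ; hE = λ { (inj₁ (() , _)) ; (inj₂ (tt , e)) → e }
  ; hI = λ { (inj₁ (() , _)) ; (inj₂ (tt , i)) → i }
  ; ς-comm = λ { (inj₁ (() , _)) ; (inj₂ (tt , i)) → refl }
  ; ω-comm = λ { (inj₁ (() , _)) ; (inj₂ (tt , i)) → refl } }

unitʳ□R : ∀ {G} → RHom (G □R 𝟙R) G
unitʳ□R = record
  { hV = λ { (x , tt) → x }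
  ; hE = λ { (inj₁ (e , tt)) → e ; (inj₂ (_ , ())) }
  ; hI = λ { (inj₁ (i , tt)) → i ; (inj₂ (_ , ())) }
  ; ς-comm = λ { (inj₁ (i , tt)) → refl ; (inj₂ (_ , ())) }
  ; ω-comm = λ { (inj₁ (i , tt)) → refl ; (inj₂ (_ , ())) } }

RBox : MonCat
RBox = record
  { Obj = IncHyp ; Hom = RHom ; _≈_ = _≈R_ ; id = idR ; _∘_ = _∘R_
  ; _⊗₀_ = _□R_ ; _⊗₁_ = _□R₁_ ; 𝟙 = 𝟙R
  ; assoc⇒ = assoc□R ; unitˡ⇒ = unitˡ□R ; unitʳ⇒ = unitʳ□R }

-- Laplacian product.
--   vertices:   tag 1 = inj₁ (V×V),  tag 4 = inj₂ (E×E)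
--   edges:      tag 2 = inj₁ (E×V),  tag 3 = inj₂ (V×E)
--   incidences: tag 1 = inj₁ (I×V), tag 2 = inj₂ (inj₁ (I×E)),
--               tag 3 = inj₂ (inj₂ (inj₁ (E×I))), tag 4 = inj₂ (inj₂ (inj₂ (V×I)))
_■_ : IncHyp → IncHyp → IncHyp
G ■ H = record
  { Vt = (Vt G × Vt H) ⊎ (Ed G × Ed H)
  ; Ed = (Ed G × Vt H) ⊎ (Vt G × Ed H)
  ; Inc = (Inc G × Vt H) ⊎ ((Inc G × Ed H) ⊎ ((Ed G × Inc H) ⊎ (Vt G × Inc H)))
  ; ς = λ { (inj₁ (x , y)) → inj₁ (ς G x , y)
          ; (inj₂ (inj₁ (x , y))) → inj₂ (ω G x , y)
          ; (inj₂ (inj₂ (inj₁ (x , y)))) → inj₂ (x , ω H y)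
          ; (inj₂ (inj₂ (inj₂ (x , y)))) → inj₁ (x , ς H y) }
  ; ω = λ { (inj₁ (x , y)) → inj₁ (ω G x , y)
          ; (inj₂ (inj₁ (x , y))) → inj₂ (ς G x , y)
          ; (inj₂ (inj₂ (inj₁ (x , y)))) → inj₁ (x , ς H y)
          ; (inj₂ (inj₂ (inj₂ (x , y)))) → inj₂ (x , ω H y) } }

_■₁_ : ∀ {G G′ H H′} → RHom G G′ → RHom H H′ → RHom (G ■ H) (G′ ■ H′)
f ■₁ g = record
  { hV = λ { (inj₁ (x , y)) → inj₁ (hV f x , hV g y) ; (inj₂ (x , y)) → inj₂ (hE f x , hE g y) }
  ; hE = λ { (inj₁ (x , y)) → inj₁ (hE f x , hV g y) ; (inj₂ (x , y)) → inj₂ (hV f x , hE g y) }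
  ; hI = λ { (inj₁ (x , y)) → inj₁ (hI f x , hV g y)
           ; (inj₂ (inj₁ (x , y))) → inj₂ (inj₁ (hI f x , hE g y))
           ; (inj₂ (inj₂ (inj₁ (x , y)))) → inj₂ (inj₂ (inj₁ (hE f x , hI g y)))
           ; (inj₂ (inj₂ (inj₂ (x , y)))) → inj₂ (inj₂ (inj₂ (hV f x , hI g y))) }
  ; ς-comm = λ { (inj₁ (x , y)) → cong (λ z → inj₁ (z , hV g y)) (ς-comm f x)
               ; (inj₂ (inj₁ (x , y))) → cong (λ z → inj₂ (z , hE g y)) (ω-comm f x)
               ; (inj₂ (inj₂ (inj₁ (x , y)))) → cong (λ z → inj₂ (hE f x , z)) (ω-comm g y)
               ; (inj₂ (inj₂ (inj₂ (x , y)))) → cong (λ z → inj₁ (hV f x , z)) (ς-comm g y) }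
  ; ω-comm = λ { (inj₁ (x , y)) → cong (λ z → inj₁ (z , hV g y)) (ω-comm f x)
               ; (inj₂ (inj₁ (x , y))) → cong (λ z → inj₂ (z , hE g y)) (ς-comm f x)
               ; (inj₂ (inj₂ (inj₁ (x , y)))) → cong (λ z → inj₁ (hE f x , z)) (ς-comm g y)
               ; (inj₂ (inj₂ (inj₂ (x , y)))) → cong (λ z → inj₂ (hV f x , z)) (ω-comm g y) } }

assoc■ : ∀ {G H K} → RHom ((G ■ H) ■ K) (G ■ (H ■ K))
assoc■ = record
  { hV = λ { (inj₁ (inj₁ (v , w) , x)) → inj₁ (v , inj₁ (w , x))
           ; (inj₁ (inj₂ (e , f) , x)) → inj₂ (e , inj₁ (f , x))
           ; (inj₂ (inj₁ (e , w) , y)) → inj₂ (e , inj₂ (w , y))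
           ; (inj₂ (inj₂ (v , f) , y)) → inj₁ (v , inj₂ (f , y)) }
  ; hE = λ { (inj₁ (inj₁ (e , w) , x)) → inj₁ (e , inj₁ (w , x))
           ; (inj₁ (inj₂ (v , f) , x)) → inj₂ (v , inj₁ (f , x))
           ; (inj₂ (inj₁ (v , w) , y)) → inj₂ (v , inj₂ (w , y))
           ; (inj₂ (inj₂ (e , f) , y)) → inj₁ (e , inj₂ (f , y)) }
  ; hI = λ { (inj₁ (inj₁ (i , w) , x)) → inj₁ (i , inj₁ (w , x))
           ; (inj₁ (inj₂ (inj₁ (i , f)) , x)) → inj₂ (inj₁ (i , inj₁ (f , x)))
           ; (inj₁ (inj₂ (inj₂ (inj₁ (e , j))) , x)) → inj₂ (inj₂ (inj₁ (e , inj₁ (j , x))))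
           ; (inj₁ (inj₂ (inj₂ (inj₂ (v , j))) , x)) → inj₂ (inj₂ (inj₂ (v , inj₁ (j , x))))
           ; (inj₂ (inj₁ (inj₁ (i , w) , y))) → inj₂ (inj₁ (i , inj₂ (w , y)))
           ; (inj₂ (inj₁ (inj₂ (inj₁ (i , f)) , y))) → inj₁ (i , inj₂ (f , y))
           ; (inj₂ (inj₁ (inj₂ (inj₂ (inj₁ (e , j))) , y))) → inj₂ (inj₂ (inj₁ (e , inj₂ (inj₁ (j , y)))))
           ; (inj₂ (inj₁ (inj₂ (inj₂ (inj₂ (v , j))) , y))) → inj₂ (inj₂ (inj₂ (v , inj₂ (inj₁ (j , y)))))
           ; (inj₂ (inj₂ (inj₁ (inj₁ (e , w) , k)))) → inj₂ (inj₂ (inj₁ (e , inj₂ (inj₂ (inj₂ (w , k))))))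
           ; (inj₂ (inj₂ (inj₁ (inj₂ (v , f) , k)))) → inj₂ (inj₂ (inj₂ (v , inj₂ (inj₂ (inj₁ (f , k))))))
           ; (inj₂ (inj₂ (inj₂ (inj₁ (v , w) , k)))) → inj₂ (inj₂ (inj₂ (v , inj₂ (inj₂ (inj₂ (w , k))))))
           ; (inj₂ (inj₂ (inj₂ (inj₂ (e , f) , k)))) → inj₂ (inj₂ (inj₁ (e , inj₂ (inj₂ (inj₁ (f , k)))))) }
  ; ς-comm = λ { (inj₁ (inj₁ (i , w) , x)) → refl
               ; (inj₁ (inj₂ (inj₁ (i , f)) , x)) → refl
               ; (inj₁ (inj₂ (inj₂ (inj₁ (e , j))) , x)) → refl
               ; (inj₁ (inj₂ (inj₂ (inj₂ (v , j))) , x)) → refl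
               ; (inj₂ (inj₁ (inj₁ (i , w) , y))) → refl
               ; (inj₂ (inj₁ (inj₂ (inj₁ (i , f)) , y))) → refl
               ; (inj₂ (inj₁ (inj₂ (inj₂ (inj₁ (e , j))) , y))) → refl
               ; (inj₂ (inj₁ (inj₂ (inj₂ (inj₂ (v , j))) , y))) → refl
               ; (inj₂ (inj₂ (inj₁ (inj₁ (e , w) , k)))) → refl
               ; (inj₂ (inj₂ (inj₁ (inj₂ (v , f) , k)))) → refl
               ; (inj₂ (inj₂ (inj₂ (inj₁ (v , w) , k)))) → refl
               ; (inj₂ (inj₂ (inj₂ (inj₂ (e , f) , k)))) → refl }
  ; ω-comm = λ { (inj₁ (inj₁ (i , w) , x)) → refl
               ; (inj₁ (inj₂ (inj₁ (i , f)) , x)) → refl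
               ; (inj₁ (inj₂ (inj₂ (inj₁ (e , j))) , x)) → refl
               ; (inj₁ (inj₂ (inj₂ (inj₂ (v , j))) , x)) → refl
               ; (inj₂ (inj₁ (inj₁ (i , w) , y))) → refl
               ; (inj₂ (inj₁ (inj₂ (inj₁ (i , f)) , y))) → refl
               ; (inj₂ (inj₁ (inj₂ (inj₂ (inj₁ (e , j))) , y))) → refl
               ; (inj₂ (inj₁ (inj₂ (inj₂ (inj₂ (v , j))) , y))) → refl
               ; (inj₂ (inj₂ (inj₁ (inj₁ (e , w) , k)))) → refl
               ; (inj₂ (inj₂ (inj₁ (inj₂ (v , f) , k)))) → refl
               ; (inj₂ (inj₂ (inj₂ (inj₁ (v , w) , k)))) → refl
               ; (inj₂ (inj₂ (inj₂ (inj₂ (e , f) , k)))) → refl } }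

unitˡ■ : ∀ {G} → RHom (𝟙R ■ G) G
unitˡ■ = record
  { hV = λ { (inj₁ (tt , x)) → x ; (inj₂ (() , _)) }
  ; hE = λ { (inj₁ (() , _)) ; (inj₂ (tt , e)) → e }
  ; hI = λ { (inj₁ (() , _)) ; (inj₂ (inj₁ (() , _))) ; (inj₂ (inj₂ (inj₁ (() , _))))
           ; (inj₂ (inj₂ (inj₂ (tt , j)))) → j }
  ; ς-comm = λ { (inj₁ (() , _)) ; (inj₂ (inj₁ (() , _))) ; (inj₂ (inj₂ (inj₁ (() , _))))
               ; (inj₂ (inj₂ (inj₂ (tt , j)))) → refl }
  ; ω-comm = λ { (inj₁ (() , _)) ; (inj₂ (inj₁ (() , _))) ; (inj₂ (inj₂ (inj₁ (() , _))))
               ; (inj₂ (inj₂ (inj₂ (tt , j)))) → refl } }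

unitʳ■ : ∀ {G} → RHom (G ■ 𝟙R) G
unitʳ■ = record
  { hV = λ { (inj₁ (x , tt)) → x ; (inj₂ (_ , ())) }
  ; hE = λ { (inj₁ (e , tt)) → e ; (inj₂ (_ , ())) }
  ; hI = λ { (inj₁ (i , tt)) → i ; (inj₂ (inj₁ (_ , ()))) ; (inj₂ (inj₂ (inj₁ (_ , ()))))
           ; (inj₂ (inj₂ (inj₂ (_ , ())))) }
  ; ς-comm = λ { (inj₁ (i , tt)) → refl ; (inj₂ (inj₁ (_ , ()))) ; (inj₂ (inj₂ (inj₁ (_ , ()))))
               ; (inj₂ (inj₂ (inj₂ (_ , ())))) }
  ; ω-comm = λ { (inj₁ (i , tt)) → refl ; (inj₂ (inj₁ (_ , ()))) ; (inj₂ (inj₂ (inj₁ (_ , ()))))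
               ; (inj₂ (inj₂ (inj₂ (_ , ())))) } }

RLap : MonCat
RLap = record
  { Obj = IncHyp ; Hom = RHom ; _≈_ = _≈R_ ; id = idR ; _∘_ = _∘R_
  ; _⊗₀_ = _■_ ; _⊗₁_ = _■₁_ ; 𝟙 = 𝟙R
  ; assoc⇒ = assoc■ ; unitˡ⇒ = unitˡ■ ; unitʳ⇒ = unitʳ■ }

Υ₀ : Quiver → IncHyp
Υ₀ Q = record { Vt = V Q ; Ed = V Q ; Inc = E Q ; ς = src Q ; ω = tgt Q }

Υ₁ : ∀ {Q P} → QHom Q P → RHom (Υ₀ Q) (Υ₀ P)
Υ₁ f = record { hV = fV f ; hE = fV f ; hI = fE f ; ς-comm = src-comm f ; ω-comm = tgt-comm f }

-- left adjoint Υ◇: vertices (1,v) = inj₁ v, (2,e) = inj₂ e; edges = incidences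
Υ◇₀ : IncHyp → Quiver
Υ◇₀ G = record { V = Vt G ⊎ Ed G ; E = Inc G ; src = λ i → inj₁ (ς G i) ; tgt = λ i → inj₂ (ω G i) }

Υ◇₁ : ∀ {G H} → RHom G H → QHom (Υ◇₀ G) (Υ◇₀ H)
Υ◇₁ h = record
  { fV = λ { (inj₁ v) → inj₁ (hV h v) ; (inj₂ e) → inj₂ (hE h e) }
  ; fE = hI h
  ; src-comm = λ i → cong inj₁ (ς-comm h i)
  ; tgt-comm = λ i → cong inj₂ (ω-comm h i) }

-- right adjoint Υ⋆: vertices V×E; an edge (i , e , v) goes from (ς i , e) to (v , ω i)
Υ⋆₀ : IncHyp → Quiver
Υ⋆₀ G = record
  { V = Vt G × Ed G
  ; E = Inc G × Ed G × Vt G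
  ; src = λ { (i , e , v) → (ς G i , e) }
  ; tgt = λ { (i , e , v) → (v , ω G i) } }

Υ⋆₁ : ∀ {G H} → RHom G H → QHom (Υ⋆₀ G) (Υ⋆₀ H)
Υ⋆₁ h = record
  { fV = λ { (v , e) → (hV h v , hE h e) }
  ; fE = λ { (i , e , v) → (hI h i , hE h e , hV h v) }
  ; src-comm = λ { (i , e , v) → cong (λ z → z , hE h e) (ς-comm h i) }
  ; tgt-comm = λ { (i , e , v) → cong (λ z → hV h v , z) (ω-comm h i) } }

Υ-Lap : Fun QuivBox RLap
Υ-Lap = record { F₀ = Υ₀ ; F₁ = Υ₁ }

Υ-Box : Fun QuivBox RBox
Υ-Box = record { F₀ = Υ₀ ; F₁ = Υ₁ }

Υ⋆-Lap : Fun RLap QuivBox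
Υ⋆-Lap = record { F₀ = Υ⋆₀ ; F₁ = Υ⋆₁ }

Υ⋆-Box : Fun RBox QuivBox
Υ⋆-Box = record { F₀ = Υ⋆₀ ; F₁ = Υ⋆₁ }

Υ◇-Lap : Fun RLap QuivBox
Υ◇-Lap = record { F₀ = Υ◇₀ ; F₁ = Υ◇₁ }

Υ◇-Box : Fun RBox QuivBox
Υ◇-Box = record { F₀ = Υ◇₀ ; F₁ = Υ◇₁ }

{-# OPTIONS --safe #-}
module Submission where

-- Each failure is already visible at the level of objects, before any coherence law.
-- For Υ, the edge set of Υ(𝟙) is the (nonempty) vertex set of the one-vertex quiver,
-- so there is no map Υ(𝟙) → 𝟙 inverting φ₀. For Υ⋆, the vertex set of Υ⋆(𝟙) is
-- V × E = ⊤ × ⊥, so there is no φ₀ : 𝟙 → Υ⋆(𝟙). For Υ◇, every edge of Υ◇ G runs from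
-- a vertex of G to an edge of G, so Υ◇ G has no path of length two; but the box
-- product of two such quivers does, and quiver homomorphisms preserve such paths.

open import Defs
open import Data.Product using (_×_; _,_; ∃₂)
open import Data.Sum using (inj₁; inj₂)
open import Data.Unit using (⊤; tt)
open import Data.Empty using (⊥)
open import Relation.Nullary using (¬_)
open import Relation.Binary.PropositionalEquality using (_≡_; refl; sym; trans; cong)

open Quiver
open IncHyp using (Ed)
open QHom

module _ {C D : MonCat} {F : Fun C D} where
  open Fun F

  ¬strong-if-no-unit-inverse : ¬ MonCat.Hom D (F₀ (MonCat.𝟙 C)) (MonCat.𝟙 D) →
                               ¬ StrongMonoidal C D F
  ¬strong-if-no-unit-inverse noInv s = noInv (IsIso.inv (StrongMonoidal.φ₀-iso s))

  ¬strong-if-no-unit-map : ¬ MonCat.Hom D (MonCat.𝟙 D) (F₀ (MonCat.𝟙 C)) →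
                           ¬ StrongMonoidal C D F
  ¬strong-if-no-unit-map noMap s = noMap (StrongMonoidal.φ₀ s)

  ¬strong-if-no-comparison : ∀ A B →
    ¬ MonCat.Hom D (MonCat._⊗₀_ D (F₀ A) (F₀ B)) (F₀ (MonCat._⊗₀_ C A B)) →
    ¬ StrongMonoidal C D F
  ¬strong-if-no-comparison A B noMap s = noMap (StrongMonoidal.φ s A B)

¬RHom-from-edge : ∀ {G H} → Ed G → (Ed H → ⊥) → ¬ RHom G H
¬RHom-from-edge e noEdge h = noEdge (RHom.hE h e)

¬QHom-to-vertexless : ∀ {Q P} → V Q → (V P → ⊥) → ¬ QHom Q P
¬QHom-to-vertexless v noVertex f = noVertex (fV f v)

HasPath₂ : Quiver → Set
HasPath₂ Q = ∃₂ λ (d e : E Q) → tgt Q d ≡ src Q e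

QHom-preserves-HasPath₂ : ∀ {Q P} → QHom Q P → HasPath₂ Q → HasPath₂ P
QHom-preserves-HasPath₂ f (d , e , d→e) =
  fE f d , fE f e , trans (tgt-comm f d) (trans (cong (fV f) d→e) (sym (src-comm f e)))

Υ◇-¬HasPath₂ : ∀ G → ¬ HasPath₂ (Υ◇₀ G)
Υ◇-¬HasPath₂ G (_ , _ , ())

□Q-HasPath₂ : ∀ {Q P} → E Q → E P → HasPath₂ (Q □Q P)
□Q-HasPath₂ {Q} {P} d e = inj₁ (d , src P e) , inj₂ (tgt Q d , e) , refl

¬QHom-□Q-to-Υ◇ : ∀ {Q P} G → E Q → E P → ¬ QHom (Q □Q P) (Υ◇₀ G)
¬QHom-□Q-to-Υ◇ G d e f = Υ◇-¬HasPath₂ G (QHom-preserves-HasPath₂ f (□Q-HasPath₂ d e))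

loop : IncHyp
loop = record { Vt = ⊤ ; Ed = ⊤ ; Inc = ⊤ ; ς = λ _ → tt ; ω = λ _ → tt }

mainTheorem7 : (¬ StrongMonoidal QuivBox RLap Υ-Lap)
    × (¬ StrongMonoidal QuivBox RBox Υ-Box)
    × (¬ StrongMonoidal RLap QuivBox Υ⋆-Lap)
    × (¬ StrongMonoidal RBox QuivBox Υ⋆-Box)
    × (¬ StrongMonoidal RLap QuivBox Υ◇-Lap)
    × (¬ StrongMonoidal RBox QuivBox Υ◇-Box)
mainTheorem7 =
    ¬strong-if-no-unit-inverse Υ-unit-not-edgeless
  , ¬strong-if-no-unit-inverse Υ-unit-not-edgeless
  , ¬strong-if-no-unit-map Υ⋆-unit-vertexless
  , ¬strong-if-no-unit-map Υ⋆-unit-vertexless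
  , ¬strong-if-no-comparison loop loop (¬QHom-□Q-to-Υ◇ (loop ■ loop) tt tt)
  , ¬strong-if-no-comparison loop loop (¬QHom-□Q-to-Υ◇ (loop □R loop) tt tt)
  where
  Υ-unit-not-edgeless : ¬ RHom (Υ₀ 𝟙Q) 𝟙R
  Υ-unit-not-edgeless = ¬RHom-from-edge tt λ ()

  Υ⋆-unit-vertexless : ¬ QHom 𝟙Q (Υ⋆₀ 𝟙R)
  Υ⋆-unit-vertexless = ¬QHom-to-vertexless tt λ ()
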